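{- Let $G=(V,E)$ be a (possibly infinite) graph, and let $\Phi_G:\mathrm{Aut}(G)\to\mathrm{Aut}(\underline{\chi}(G,\bullet))$ be the group homomorphism sending $\varphi$ to the natural automorphism $\overline{\varphi}$ whose component at a set $S$ is $\overline{\varphi}_S(c)=c\circ\varphi^{ -1}$. Then $\Phi_G$ is injective. Moreover, $\Phi_G$ is an isomorphism if and only if $G$ is a complete graph or $G$ is the graph with $2$ vertices and no edges.
   Context: Graphs are simple undirected graphs (no loops or multiple edges), possibly infinite; $\mathrm{Aut}(G)$ is the group of graph automorphisms. $\mathbf{Set}^{\mathbf{inj}}$ is the category of sets and injections. The chromatic functor $\underline{\chi}(G,\bullet):\mathbf{Set}^{\mathbf{inj}}\to\mathbf{Set}^{\mathbf{inj}}$ sends a set $S$ to $\underline{\chi}(G,S)=\{c:V\to S\mid c(v)\neq c(u)\text{ whenever }\{v,u\}\in E\}$ and an injection $\iota:S\to T$ to $c\mapsto\iota\circ c$; $\mathrm{Aut}(\underline{\chi}(G,\bullet))$ is its group of natural automorphisms. -}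

module Defs where

open import Level using (0ℓ)
open import Data.Fin using (Fin)
open import Data.Product using (Σ; _×_; _,_)
open import Data.Sum using (_⊎_)
open import Relation.Nullary using (¬_)
open import Relation.Binary.PropositionalEquality
  using (_≡_; _≢_; refl; sym; trans; cong; subst; subst₂)
open import Function.Definitions using (Injective)

record Graph : Set₁ where
  field
    V      : Set
    Adj    : V → V → Set
    adj-sym : ∀ {u v} → Adj u v → Adj v u
    irrefl : ∀ {v} → ¬ Adj v v

module _ (G : Graph) where
  open Graph G

  record GAut : Set where
    field
      to       : V → V
      from     : V → V
      from-to  : ∀ v → from (to v) ≡ v
      to-from  : ∀ v → to (from v) ≡ v
      adj-pres : ∀ {u v} → Adj u v → Adj (to u) (to v)
      adj-refl : ∀ {u v} → Adj (to u) (to v) → Adj u v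

  _≈A_ : GAut → GAut → Set
  φ ≈A ψ = ∀ v → GAut.to φ v ≡ GAut.to ψ v

  record Col (S : Set) : Set where
    constructor col
    field
      c      : V → S
      proper : ∀ {u v} → Adj u v → c u ≢ c v

  _≈C_ : ∀ {S} → Col S → Col S → Set
  a ≈C b = ∀ v → Col.c a v ≡ Col.c b v

  push : ∀ {S T} (ι : S → T) → Injective _≡_ _≡_ ι → Col S → Col T
  push ι inj (col c p) = col (λ v → ι (c v)) (λ a e → p a (inj e))

  -- natural automorphisms of the chromatic functor χ(G,•) : Set^inj → Set^inj
  -- (colourings compared extensionally, so components must respect ≈C)
  record NatAut : Set₁ where
    field
      η        : (S : Set) → Col S → Col S
      η⁻¹      : (S : Set) → Col S → Col S
      η-cong   : ∀ S {a b} → a ≈C b → η S a ≈C η S b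
      η⁻¹-cong : ∀ S {a b} → a ≈C b → η⁻¹ S a ≈C η⁻¹ S b
      η-η⁻¹    : ∀ S a → η S (η⁻¹ S a) ≈C a
      η⁻¹-η    : ∀ S a → η⁻¹ S (η S a) ≈C a
      natural  : ∀ S T (ι : S → T) (inj : Injective _≡_ _≡_ ι) a →
                 η T (push ι inj a) ≈C push ι inj (η S a)

  _≈N_ : NatAut → NatAut → Set₁
  θ ≈N ζ = ∀ S a → NatAut.η θ S a ≈C NatAut.η ζ S a

  act : GAut → ∀ {S} → Col S → Col S
  act φ (col c p) = col (λ v → c (from v))
    (λ {u} {v} a → p (adj-refl (subst₂ Adj (sym (to-from u)) (sym (to-from v)) a)))
    where open GAut φ

  Φ : GAut → NatAut
  Φ φ = record
    { η        = λ S → act φ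
    ; η⁻¹      = λ S → act φ⁻
    ; η-cong   = λ S e v → e (from v)
    ; η⁻¹-cong = λ S e v → e (to v)
    ; η-η⁻¹    = λ S a v → cong (Col.c a) (to-from v)
    ; η⁻¹-η    = λ S a v → cong (Col.c a) (from-to v)
    ; natural  = λ S T ι inj a v → refl
    }
    where
      open GAut φ
      φ⁻ : GAut
      φ⁻ = record
        { to = from ; from = to ; from-to = to-from ; to-from = from-to
        ; adj-pres = λ {u} {v} a →
            adj-refl (subst₂ Adj (sym (to-from u)) (sym (to-from v)) a)
        ; adj-refl = λ {u} {v} a →
            subst₂ Adj (to-from u) (to-from v) (adj-pres a) }

  Φ-Injective : Set₁
  Φ-Injective = ∀ φ ψ → Φ φ ≈N Φ ψ → φ ≈A ψ

  Φ-Surjective : Set₁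
  Φ-Surjective = ∀ (θ : NatAut) → Σ GAut λ φ → Φ φ ≈N θ

  Φ-IsIso : Set₁
  Φ-IsIso = Φ-Injective × Φ-Surjective

  IsComplete : Set
  IsComplete = ∀ u v → u ≢ v → Adj u v

  IsEmpty2 : Set
  IsEmpty2 = (Σ (V → Fin 2) λ f → Σ (Fin 2 → V) λ g →
               (∀ v → g (f v) ≡ v) × (∀ i → f (g i) ≡ i))
             × (∀ u v → ¬ Adj u v)

-- A natural automorphism θ is determined on injective colourings by
-- naturality: θ_S(c) = c ∘ c₀ where c₀ = vertexMap θ = θ_V(id_V), as id_V is proper.
-- Evaluating at id_V already gives injectivity of Φ.  In a complete graph
-- every proper colouring is injective; in the edgeless graph on two vertices
-- every colouring is injective or constant, and constant colourings factor
-- through a one-point set, so θ fixes them.  In both cases θ = Φ(c₀⁻¹).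
-- Conversely, if u ≠ v are non-adjacent and w is a third vertex, swapping the
-- colours of u and w in exactly those colourings with c(u) = c(v) is a natural
-- automorphism fixing id_V that is not of the form c ↦ c ∘ φ⁻¹.
module Submission where

open import Defs
import Level
open Level using (0ℓ; lift; lower)
open import Axiom.ExcludedMiddle using (ExcludedMiddle)
open import Data.Product using (_×_; _,_; Σ; ∃-syntax; proj₂)
open import Data.Sum using (_⊎_; inj₁; inj₂; [_,_]′)
open import Function using (_∘_; const)
open import Function.Bundles using (_⇔_; mk⇔; Equivalence)
open import Function.Definitions using (Injective)
open import Data.Fin using (Fin; zero; suc)
open import Data.Unit using (⊤; tt)
open import Relation.Nullary using (¬_; Dec; yes; no; contradiction)
open import Relation.Nullary.Decidable using (map′; decidable-stable)
open import Relation.Binary.Definitions using (DecidableEquality)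
open import Relation.Binary.PropositionalEquality
  using (_≡_; _≢_; _≗_; refl; sym; trans; cong; cong₂; subst; module ≡-Reasoning)

Edgeless : Graph → Set
Edgeless G = ∀ u v → ¬ Graph.Adj G u v

EdgelessPair : Graph → Set
EdgelessPair G = Σ V λ p → Σ V λ q → p ≢ q × (∀ x → x ≡ p ⊎ x ≡ q) × Edgeless G
  where open Graph G

module _ {G : Graph} where
  open Graph G

  infix 4 _≈_
  _≈_ : ∀ {S} → Col G S → Col G S → Set
  _≈_ = _≈C_ G

  adjacent⇒distinct : ∀ {x y} → Adj x y → x ≢ y
  adjacent⇒distinct a refl = irrefl a

  complete-injective⇒preserves : IsComplete G → (h : V → V) → Injective _≡_ _≡_ h →
                                 ∀ {x y} → Adj x y → Adj (h x) (h y)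
  complete-injective⇒preserves complete h h-inj a =
    complete _ _ (adjacent⇒distinct a ∘ h-inj)

  complete⇒reflects : IsComplete G → (h : V → V) → ∀ {x y} → Adj (h x) (h y) → Adj x y
  complete⇒reflects complete h {x} {y} a = complete x y (adjacent⇒distinct a ∘ cong h)

  cover⇒edgeless : ∀ {u v} → (∀ x → x ≡ u ⊎ x ≡ v) → ¬ Adj u v → Edgeless G
  cover⇒edgeless cover ¬uv x y a with cover x | cover y
  ... | inj₁ refl | inj₁ refl = irrefl a
  ... | inj₂ refl | inj₂ refl = irrefl a
  ... | inj₁ refl | inj₂ refl = ¬uv a
  ... | inj₂ refl | inj₁ refl = ¬uv (adj-sym a)

  isEmpty2⇒edgelessPair : IsEmpty2 G → EdgelessPair G
  isEmpty2⇒edgelessPair ((f , g , g∘f≗id , f∘g≗id) , edgeless) =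
    g zero , g (suc zero) , distinct , cover , edgeless
    where
      distinct : g zero ≢ g (suc zero)
      distinct e with trans (sym (f∘g≗id zero)) (trans (cong f e) (f∘g≗id (suc zero)))
      ... | ()

      cover : ∀ x → x ≡ g zero ⊎ x ≡ g (suc zero)
      cover x with f x | g∘f≗id x
      ... | zero     | e = inj₁ (sym e)
      ... | suc zero | e = inj₂ (sym e)

  edgelessPair⇒isEmpty2 : EdgelessPair G → IsEmpty2 G
  edgelessPair⇒isEmpty2 (p , q , p≢q , cover , edgeless) =
    (index , vertex , vertex∘index≗id , index∘vertex≗id) , edgeless
    where
      index : V → Fin 2
      index x with cover x
      ... | inj₁ _ = zero
      ... | inj₂ _ = suc zero

      vertex : Fin 2 → V
      vertex zero       = p
      vertex (suc zero) = q

      vertex∘index≗id : ∀ x → vertex (index x) ≡ x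
      vertex∘index≗id x with cover x
      ... | inj₁ x≡p = sym x≡p
      ... | inj₂ x≡q = sym x≡q

      index∘vertex≗id : ∀ i → index (vertex i) ≡ i
      index∘vertex≗id zero with cover p
      ... | inj₁ _   = refl
      ... | inj₂ p≡q = contradiction p≡q p≢q
      index∘vertex≗id (suc zero) with cover q
      ... | inj₁ q≡p = contradiction (sym q≡p) p≢q
      ... | inj₂ _   = refl

  identityColouring : Col G V
  identityColouring = col (λ x → x) adjacent⇒distinct

  constantColouring : Edgeless G → {S : Set} → S → Col G S
  constantColouring edgeless s = col (const s) (λ {u} {v} a _ → edgeless u v a)

  Φ-injective : Φ-Injective G
  Φ-injective φ ψ Φφ≈Φψ v = begin
    to φ v                  ≡⟨ to-from ψ (to φ v) ⟨
    to ψ (from ψ (to φ v))  ≡⟨ cong (to ψ) (Φφ≈Φψ V identityColouring (to φ v)) ⟨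
    to ψ (from φ (to φ v))  ≡⟨ cong (to ψ) (from-to φ v) ⟩
    to ψ v                  ∎
    where open GAut
          open ≡-Reasoning

  module _ (θ : NatAut G) where
    open NatAut θ

    η-injective : ∀ S {a b} → η S a ≈ η S b → a ≈ b
    η-injective S {a} {b} ηa≈ηb x =
      trans (sym (η⁻¹-η S a x)) (trans (η⁻¹-cong S ηa≈ηb x) (η⁻¹-η S b x))

    vertexMap : V → V
    vertexMap = Col.c (η V identityColouring)

    -- naturality along a itself, as a = a ∘ id_V
    η-onInjective : ∀ S (a : Col G S) → Injective _≡_ _≡_ (Col.c a) →
                    Col.c (η S a) ≗ Col.c a ∘ vertexMap
    η-onInjective S a a-inj x =
      trans (η-cong S {a} {push G (Col.c a) a-inj identityColouring} (λ _ → refl) x)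
            (natural V S (Col.c a) a-inj identityColouring x)

    -- naturality along s : ⊤ → S
    η-onConstant : Edgeless G → ∀ S (a : Col G S) (s : S) →
                   Col.c a ≗ const s → Col.c (η S a) ≗ const s
    η-onConstant edgeless S a s a≡s x =
      trans (η-cong S {a} {push G (const s) (λ _ → refl) point} a≡s x)
            (natural ⊤ S (const s) (λ _ → refl) point x)
      where
        point : Col G ⊤
        point = constantColouring edgeless tt

    vertexMap-constant⇒subsingleton : Edgeless G → ∀ w → vertexMap ≗ const w →
                                      ∀ (x y : V) → x ≡ y
    vertexMap-constant⇒subsingleton edgeless w vertexMap≡w x y =
      trans (x≡w x) (sym (x≡w y))
      where
        x≡w : ∀ x → x ≡ w
        x≡w = η-injective V λ x →
          trans (vertexMap≡w x)
                (sym (η-onConstant edgeless V (constantColouring edgeless w) w (λ _ → refl) x))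

  _⁻¹ : NatAut G → NatAut G
  θ ⁻¹ = record
    { η        = η⁻¹
    ; η⁻¹      = η
    ; η-cong   = η⁻¹-cong
    ; η⁻¹-cong = η-cong
    ; η-η⁻¹    = η⁻¹-η
    ; η⁻¹-η    = η-η⁻¹
    ; natural  = natural⁻¹
    }
    where
      open NatAut θ

      natural⁻¹ : ∀ S T (ι : S → T) (inj : Injective _≡_ _≡_ ι) a →
                  η⁻¹ T (push G ι inj a) ≈ push G ι inj (η⁻¹ S a)
      natural⁻¹ S T ι inj a = η-injective θ T λ x →
        trans (η-η⁻¹ T (push G ι inj a) x)
              (sym (trans (natural S T ι inj (η⁻¹ S a) x) (cong ι (η-η⁻¹ S a x))))

  vertexMap-inverseˡ : (θ : NatAut G) → Injective _≡_ _≡_ (vertexMap (θ ⁻¹)) →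
                       ∀ x → vertexMap (θ ⁻¹) (vertexMap θ x) ≡ x
  vertexMap-inverseˡ θ vertexMap⁻¹-inj x =
    trans (sym (η-onInjective θ V (NatAut.η⁻¹ θ V identityColouring) vertexMap⁻¹-inj x))
          (NatAut.η-η⁻¹ θ V identityColouring x)

  vertexAut : (θ : NatAut G) →
              Injective _≡_ _≡_ (vertexMap θ) → Injective _≡_ _≡_ (vertexMap (θ ⁻¹)) →
              (∀ {x y} → Adj x y → Adj (vertexMap (θ ⁻¹) x) (vertexMap (θ ⁻¹) y)) →
              (∀ {x y} → Adj (vertexMap (θ ⁻¹) x) (vertexMap (θ ⁻¹) y) → Adj x y) →
              GAut G
  vertexAut θ vertexMap-inj vertexMap⁻¹-inj preserves reflects = record
    { to       = vertexMap (θ ⁻¹)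
    ; from     = vertexMap θ
    ; from-to  = vertexMap-inverseˡ (θ ⁻¹) vertexMap-inj
    ; to-from  = vertexMap-inverseˡ θ vertexMap⁻¹-inj
    ; adj-pres = preserves
    ; adj-refl = reflects
    }

module Classical (em : ExcludedMiddle (Level.suc 0ℓ)) where

  decide : (P : Set) → Dec P
  decide P = map′ lower lift em

  infix 4 _≟_
  _≟_ : {S : Set} → DecidableEquality S
  x ≟ y = decide (x ≡ y)

  no-third⇒cover : {A : Set} {u v : A} → ¬ (∃[ w ] w ≢ u × w ≢ v) → ∀ x → x ≡ u ⊎ x ≡ v
  no-third⇒cover {u = u} {v} noThird x with x ≟ u | x ≟ v
  ... | yes x≡u | _       = inj₁ x≡u
  ... | no _    | yes x≡v = inj₂ x≡v
  ... | no x≢u  | no x≢v  = contradiction (x , x≢u , x≢v) noThird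

  cover⇒injective⊎constant : {A S : Set} {p q : A} → (∀ x → x ≡ p ⊎ x ≡ q) →
                             (h : A → S) → Injective _≡_ _≡_ h ⊎ (∀ x → h x ≡ h p)
  cover⇒injective⊎constant {p = p} {q} cover h with h p ≟ h q
  ... | yes hp≡hq = inj₂ constant
    where
      constant : ∀ x → h x ≡ h p
      constant x with cover x
      ... | inj₁ refl = refl
      ... | inj₂ refl = sym hp≡hq
  ... | no hp≢hq = inj₁ injective
    where
      injective : Injective _≡_ _≡_ h
      injective {x} {y} hx≡hy with cover x | cover y
      ... | inj₁ refl | inj₁ refl = refl
      ... | inj₂ refl | inj₂ refl = refl
      ... | inj₁ refl | inj₂ refl = contradiction hx≡hy hp≢hq
      ... | inj₂ refl | inj₁ refl = contradiction (sym hx≡hy) hp≢hq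

  transpose : {S : Set} → S → S → S → S
  transpose α β z with z ≟ α
  ... | yes _ = β
  ... | no _ with z ≟ β
  ...   | yes _ = α
  ...   | no _  = z

  module _ {S : Set} {α β z : S} where

    transpose-≡ˡ : z ≡ α → transpose α β z ≡ β
    transpose-≡ˡ z≡α with z ≟ α
    ... | yes _   = refl
    ... | no z≢α  = contradiction z≡α z≢α

    transpose-≡ʳ : z ≢ α → z ≡ β → transpose α β z ≡ α
    transpose-≡ʳ z≢α z≡β with z ≟ α
    ... | yes z≡α = contradiction z≡α z≢α
    ... | no _ with z ≟ β
    ...   | yes _   = refl
    ...   | no z≢β  = contradiction z≡β z≢β

    transpose-≢ : z ≢ α → z ≢ β → transpose α β z ≡ z
    transpose-≢ z≢α z≢β with z ≟ α
    ... | yes z≡α = contradiction z≡α z≢α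
    ... | no _ with z ≟ β
    ...   | yes z≡β = contradiction z≡β z≢β
    ...   | no _    = refl

  transpose-matchʳ : {S : Set} (α β : S) → transpose α β β ≡ α
  transpose-matchʳ α β = by-cases (β ≟ α)
    where
      by-cases : Dec (β ≡ α) → transpose α β β ≡ α
      by-cases (yes β≡α) = trans (transpose-≡ˡ β≡α) β≡α
      by-cases (no β≢α)  = transpose-≡ʳ β≢α refl

  transpose-inverse : {S : Set} (α β z : S) → transpose β α (transpose α β z) ≡ z
  transpose-inverse α β z = by-cases (z ≟ α) (z ≟ β)
    where
      by-cases : Dec (z ≡ α) → Dec (z ≡ β) → transpose β α (transpose α β z) ≡ z
      by-cases (yes z≡α) _ =
        trans (cong (transpose β α) (transpose-≡ˡ z≡α))
              (trans (transpose-≡ˡ refl) (sym z≡α))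
      by-cases (no z≢α) (yes z≡β) =
        trans (cong (transpose β α) (transpose-≡ʳ z≢α z≡β))
              (trans (transpose-matchʳ β α) (sym z≡β))
      by-cases (no z≢α) (no z≢β) =
        trans (cong (transpose β α) (transpose-≢ z≢α z≢β)) (transpose-≢ z≢β z≢α)

  transpose-injective : {S : Set} (α β : S) → Injective _≡_ _≡_ (transpose α β)
  transpose-injective α β {x} {y} e =
    trans (sym (transpose-inverse α β x))
          (trans (cong (transpose β α) e) (transpose-inverse α β y))

  transpose-natural : {S T : Set} {ι : S → T} → Injective _≡_ _≡_ ι → (α β z : S) →
                 transpose (ι α) (ι β) (ι z) ≡ ι (transpose α β z)
  transpose-natural {ι = ι} ι-inj α β z = by-cases (z ≟ α) (z ≟ β)
    where
      by-cases : Dec (z ≡ α) → Dec (z ≡ β) →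
                 transpose (ι α) (ι β) (ι z) ≡ ι (transpose α β z)
      by-cases (yes z≡α) _ =
        trans (transpose-≡ˡ (cong ι z≡α)) (sym (cong ι (transpose-≡ˡ z≡α)))
      by-cases (no z≢α) (yes z≡β) =
        trans (transpose-≡ʳ (z≢α ∘ ι-inj) (cong ι z≡β))
              (sym (cong ι (transpose-≡ʳ z≢α z≡β)))
      by-cases (no z≢α) (no z≢β) =
        trans (transpose-≢ (z≢α ∘ ι-inj) (z≢β ∘ ι-inj))
              (sym (cong ι (transpose-≢ z≢α z≢β)))

  module _ {G : Graph} where
    open Graph G

    complete⇒injective : IsComplete G → ∀ {S} (a : Col G S) → Injective _≡_ _≡_ (Col.c a)
    complete⇒injective complete a {x} {y} ax≡ay with x ≟ y
    ... | yes x≡y = x≡y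
    ... | no x≢y  = contradiction ax≡ay (Col.proper a (complete x y x≢y))

    complete⇒Φ-surjective : IsComplete G → Φ-Surjective G
    complete⇒Φ-surjective complete θ =
      vertexAut θ (injective (η V identityColouring)) vertexMap⁻¹-injective
        (complete-injective⇒preserves {G} complete (vertexMap (θ ⁻¹)) vertexMap⁻¹-injective)
        (complete⇒reflects {G} complete (vertexMap (θ ⁻¹)))
      , λ S a x → sym (η-onInjective θ S a (injective a) x)
      where
        open NatAut θ
        injective : ∀ {S} (a : Col G S) → Injective _≡_ _≡_ (Col.c a)
        injective = complete⇒injective complete
        vertexMap⁻¹-injective : Injective _≡_ _≡_ (vertexMap (θ ⁻¹))
        vertexMap⁻¹-injective = injective (η⁻¹ V identityColouring)

    edgelessPair⇒Φ-surjective : EdgelessPair G → Φ-Surjective G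
    edgelessPair⇒Φ-surjective (p , q , p≢q , cover , edgeless) θ =
      vertexAut θ (vertexMap-injective θ) (vertexMap-injective (θ ⁻¹))
        (λ a → contradiction a (edgeless _ _))
        (λ a → contradiction a (edgeless _ _))
      , λ S a → Φφ≈θ S a (cover⇒injective⊎constant cover (Col.c a))
      where
        vertexMap-injective : ∀ ζ → Injective _≡_ _≡_ (vertexMap ζ)
        vertexMap-injective ζ with cover⇒injective⊎constant cover (vertexMap ζ)
        ... | inj₁ injective = injective
        ... | inj₂ constant  =
          contradiction (vertexMap-constant⇒subsingleton ζ edgeless _ constant p q) p≢q

        Φφ≈θ : ∀ S a → Injective _≡_ _≡_ (Col.c a) ⊎ (∀ x → Col.c a x ≡ Col.c a p) →
               ∀ x → Col.c a (vertexMap θ x) ≡ Col.c (NatAut.η θ S a) x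
        Φφ≈θ S a (inj₁ injective) x = sym (η-onInjective θ S a injective x)
        Φφ≈θ S a (inj₂ constant)  x =
          trans (constant (vertexMap θ x)) (sym (η-onConstant θ edgeless S a _ constant x))

    module CollisionSwap (u v w : V) where

      recolour : {S : Set} (c : V → S) → Dec (c u ≡ c v) → V → S
      recolour c (yes _) = transpose (c u) (c w) ∘ c
      recolour c (no _)  = c

      recolour-proper : ∀ {S} (c : V → S) d → (∀ {x y} → Adj x y → c x ≢ c y) →
                        ∀ {x y} → Adj x y → recolour c d x ≢ recolour c d y
      recolour-proper c (yes _) proper a = proper a ∘ transpose-injective _ _
      recolour-proper c (no _)  proper a = proper a

      recolour-cong : ∀ {S} {c c′ : V → S} → c ≗ c′ →
                      ∀ d d′ → recolour c d ≗ recolour c′ d′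
      recolour-cong {c = c} c≗c′ (yes _) (yes _) x =
        trans (cong₂ (λ α β → transpose α β (c x)) (c≗c′ u) (c≗c′ w))
              (cong (transpose _ _) (c≗c′ x))
      recolour-cong c≗c′ (yes cu≡cv) (no c′u≢c′v) x =
        contradiction (trans (sym (c≗c′ u)) (trans cu≡cv (c≗c′ v))) c′u≢c′v
      recolour-cong c≗c′ (no cu≢cv) (yes c′u≡c′v) x =
        contradiction (trans (c≗c′ u) (trans c′u≡c′v (sym (c≗c′ v)))) cu≢cv
      recolour-cong c≗c′ (no _) (no _) = c≗c′

      recolour-involutive : ∀ {S} (c : V → S) d d′ → recolour (recolour c d) d′ ≗ c
      recolour-involutive c (yes _) (yes _) x =
        trans (cong₂ (λ α β → transpose α β (transpose (c u) (c w) (c x)))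
                     (transpose-≡ˡ refl) (transpose-matchʳ (c u) (c w)))
              (transpose-inverse (c u) (c w) (c x))
      recolour-involutive c (yes cu≡cv) (no ≢) x =
        contradiction (cong (transpose (c u) (c w)) cu≡cv) ≢
      recolour-involutive c (no cu≢cv) (yes cu≡cv) x = contradiction cu≡cv cu≢cv
      recolour-involutive c (no _) (no _) x = refl

      recolour-natural : ∀ {S T} {ι : S → T} → Injective _≡_ _≡_ ι → (c : V → S) → ∀ d d′ →
                         recolour (ι ∘ c) d′ ≗ ι ∘ recolour c d
      recolour-natural ι-inj c (yes _) (yes _) x = transpose-natural ι-inj (c u) (c w) (c x)
      recolour-natural {ι = ι} ι-inj c (yes cu≡cv) (no ≢) x = contradiction (cong ι cu≡cv) ≢
      recolour-natural ι-inj c (no cu≢cv) (yes ≡) x = contradiction (ι-inj ≡) cu≢cv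
      recolour-natural ι-inj c (no _) (no _) x = refl

      recolour-collision : ∀ {S} (c : V → S) → c u ≡ c v →
                           ∀ d → recolour c d ≗ transpose (c u) (c w) ∘ c
      recolour-collision c _ (yes _) x = refl
      recolour-collision c cu≡cv (no cu≢cv) x = contradiction cu≡cv cu≢cv

      recolour-noCollision : ∀ {S} (c : V → S) → c u ≢ c v → ∀ d → recolour c d ≗ c
      recolour-noCollision c cu≢cv (yes cu≡cv) x = contradiction cu≡cv cu≢cv
      recolour-noCollision c _ (no _) x = refl

      collision? : {S : Set} (c : V → S) → Dec (c u ≡ c v)
      collision? c = c u ≟ c v

      recolouring : ∀ S → Col G S → Col G S
      recolouring S (col c proper) =
        col (recolour c (collision? c)) (recolour-proper c (collision? c) proper)

      collisionSwap : NatAut G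
      collisionSwap = record
        { η        = recolouring
        ; η⁻¹      = recolouring
        ; η-cong   = cong′
        ; η⁻¹-cong = cong′
        ; η-η⁻¹    = involutive
        ; η⁻¹-η    = involutive
        ; natural  = λ S T ι ι-inj a →
            recolour-natural ι-inj (Col.c a) (collision? (Col.c a)) (collision? (ι ∘ Col.c a))
        }
        where
          cong′ : ∀ S {a b} → a ≈ b → recolouring S a ≈ recolouring S b
          cong′ S {a} {b} a≈b = recolour-cong a≈b (collision? (Col.c a)) (collision? (Col.c b))
          involutive : ∀ S a → recolouring S (recolouring S a) ≈ a
          involutive S a = recolour-involutive (Col.c a) (collision? (Col.c a))
                             (collision? (recolour (Col.c a) (collision? (Col.c a))))

      merge : V → V
      merge x with x ≟ v
      ... | yes _ = u
      ... | no _  = x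

      merge-≡ : merge v ≡ u
      merge-≡ with v ≟ v
      ... | yes _   = refl
      ... | no v≢v  = contradiction refl v≢v

      merge-≢ : ∀ {x} → x ≢ v → merge x ≡ x
      merge-≢ {x} x≢v with x ≟ v
      ... | yes x≡v = contradiction x≡v x≢v
      ... | no _    = refl

      mergeColouring : ¬ Adj u v → Col G V
      mergeColouring ¬uv = col merge proper
        where
          proper : ∀ {x y} → Adj x y → merge x ≢ merge y
          proper {x} {y} a with x ≟ v | y ≟ v
          ... | yes refl | yes refl = contradiction a irrefl
          ... | yes refl | no _     = λ u≡y → ¬uv (adj-sym (subst (Adj v) (sym u≡y) a))
          ... | no _     | yes refl = λ x≡u → ¬uv (subst (λ z → Adj z v) x≡u a)
          ... | no _     | no _     = adjacent⇒distinct {G} a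

      collisionSwap-∉-image : u ≢ v → ¬ Adj u v → w ≢ u → w ≢ v →
                              ∀ φ → ¬ _≈N_ G (Φ G φ) collisionSwap
      collisionSwap-∉-image u≢v ¬uv w≢u w≢v φ Φφ≈θ = w≢u (begin
        w                                   ≡⟨ merge-≢ w≢v ⟨
        merge w                             ≡⟨ cong merge (from≗id w) ⟨
        merge (GAut.from φ w)               ≡⟨ Φφ≈θ V (mergeColouring ¬uv) w ⟩
        recolour merge (collision? merge) w
          ≡⟨ recolour-collision merge merge-collides (collision? merge) w ⟩
        transpose (merge u) (merge w) (merge w)  ≡⟨ transpose-matchʳ (merge u) (merge w) ⟩
        merge u                             ≡⟨ merge-≢ u≢v ⟩
        u                                   ∎)
        where
          open ≡-Reasoning

          from≗id : ∀ x → GAut.from φ x ≡ x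
          from≗id x = trans (Φφ≈θ V identityColouring x)
                            (recolour-noCollision (λ y → y) u≢v (u ≟ v) x)

          merge-collides : merge u ≡ merge v
          merge-collides = trans (merge-≢ u≢v) (sym merge-≡)

    no-nonadjacent-pair⇒complete : ¬ (∃[ u ] ∃[ v ] u ≢ v × ¬ Adj u v) → IsComplete G
    no-nonadjacent-pair⇒complete noGap x y x≢y =
      decidable-stable (decide (Adj x y)) λ ¬xy → noGap (x , y , x≢y , ¬xy)

    Φ-surjective⇔complete⊎isEmpty2 : Φ-Surjective G ⇔ (IsComplete G ⊎ IsEmpty2 G)
    Φ-surjective⇔complete⊎isEmpty2 = mk⇔ classify
      [ complete⇒Φ-surjective , edgelessPair⇒Φ-surjective ∘ isEmpty2⇒edgelessPair {G} ]′
      where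
        classify : Φ-Surjective G → IsComplete G ⊎ IsEmpty2 G
        classify surj with decide (∃[ u ] ∃[ v ] u ≢ v × ¬ Adj u v)
        ... | no noGap = inj₁ (no-nonadjacent-pair⇒complete noGap)
        ... | yes (u , v , u≢v , ¬uv) with decide (∃[ w ] w ≢ u × w ≢ v)
        ...   | yes (w , w≢u , w≢v) =
          let open CollisionSwap u v w
              (φ , Φφ≈θ) = surj collisionSwap
          in  contradiction Φφ≈θ (collisionSwap-∉-image u≢v ¬uv w≢u w≢v φ)
        ...   | no noThird = inj₂ (edgelessPair⇒isEmpty2 {G}
                  (u , v , u≢v , cover , cover⇒edgeless {G} cover ¬uv))
          where
            cover : ∀ x → x ≡ u ⊎ x ≡ v
            cover = no-third⇒cover noThird

proposition2p6 : ExcludedMiddle (Level.suc 0ℓ) → (G : Graph) →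
    Φ-Injective G × (Φ-IsIso G ⇔ (IsComplete G ⊎ IsEmpty2 G))
proposition2p6 em G =
  Φ-injective , mk⇔ (Equivalence.to classification ∘ proj₂)
                    (λ h → Φ-injective , Equivalence.from classification h)
  where
    classification : Φ-Surjective G ⇔ (IsComplete G ⊎ IsEmpty2 G)
    classification = Classical.Φ-surjective⇔complete⊎isEmpty2 em
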